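{- Let $d\ge 4$ and $g\ge 1$ be integers and let $G$ be a $d$-regular graph of girth at least $2g+1$. Then for every integer $1\le r\le g$, \[\mathrm{wcol}_r(G)\ \ge\ \frac{d}{d-3}\left(\Bigl(\frac{d-1}{2}\Bigr)^r-1\right).\]
   Context: All graphs are finite and simple. A linear order on $V(G)$ is an injective map $L\colon V(G)\to\mathbb{N}$; $\Pi(G)$ is the set of all such orders. The length of a path is its number of edges. A vertex $u$ is weakly $r$-reachable from $v$ with respect to $L$ if there is a path $P$ of length $0\le\ell\le r$ from $v$ to $u$ with $L(u)\le L(w)$ for all $w\in V(P)$; $\mathrm{WReach}_r[G,L,v]$ is the set of such $u$. The weak $r$-colouring number is $\mathrm{wcol}_r(G)=\min_{L\in\Pi(G)}\max_{v\in V(G)}|\mathrm{WReach}_r[G,L,v]|$. -}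

module Defs where

open import Data.Nat using (ℕ; zero; suc; _+_; _*_; _∸_; _^_; _≤_; _<_)
open import Data.Fin using (Fin; zero; suc; inject₁; fromℕ)
open import Data.Bool using (Bool; T)
open import Data.Product using (Σ; ∃; _×_; _,_)
open import Data.Empty using (⊥)
open import Function.Definitions using (Injective)
open import Function.Bundles using (_↔_)
open import Relation.Binary.PropositionalEquality using (_≡_)
open import Relation.Nullary using (¬_)

record Graph : Set where
  field
    n     : ℕ
    adj   : Fin n → Fin n → Bool
    sym   : ∀ u v → adj u v ≡ adj v u
    irrefl : ∀ v → adj v v ≡ Bool.false
open Graph public

E : (G : Graph) → Fin (n G) → Fin (n G) → Set
E G u v = T (adj G u v)

Regular : ℕ → Graph → Set
Regular d G = ∀ v → Σ (Fin (n G)) (λ u → E G v u) ↔ Fin d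

-- A cycle of length k ≥ 3: k distinct vertices c 0, …, c (k-1) with
-- c i adjacent to c (i+1) and c (k-1) adjacent to c 0.
Cycle : (G : Graph) → ℕ → Set
Cycle G zero = ⊥
Cycle G (suc m) =
  Σ (Fin (suc m) → Fin (n G)) λ c →
    (2 ≤ m) × Injective _≡_ _≡_ c
    × (∀ (i : Fin m) → E G (c (inject₁ i)) (c (suc i)))
    × E G (c (fromℕ m)) (c zero)

GirthAtLeast : ℕ → Graph → Set
GirthAtLeast k G = ∀ ℓ → Cycle G ℓ → k ≤ ℓ

-- linear orders on V(G): injective maps V(G) → ℕ
LinearOrder : Graph → Set
LinearOrder G = Σ (Fin (n G) → ℕ) λ L → Injective _≡_ _≡_ L

-- A path of length ℓ (ℓ edges) from v to u: distinct vertices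
-- p 0 = v, …, p ℓ = u with consecutive vertices adjacent.
Path : (G : Graph) → ℕ → Fin (n G) → Fin (n G) → Set
Path G ℓ v u =
  Σ (Fin (suc ℓ) → Fin (n G)) λ p →
    Injective _≡_ _≡_ p
    × p zero ≡ v × p (fromℕ ℓ) ≡ u
    × (∀ (i : Fin ℓ) → E G (p (inject₁ i)) (p (suc i)))

WReach : (G : Graph) → ℕ → (Fin (n G) → ℕ) → Fin (n G) → Fin (n G) → Set
WReach G r L v u =
  Σ ℕ λ ℓ → (ℓ ≤ r) × Σ (Path G ℓ v u) λ P →
    ∀ (i : Fin (suc ℓ)) → L u ≤ L (Data.Product.proj₁ P i)

WReachSizeAtLeast : (G : Graph) → ℕ → (Fin (n G) → ℕ) → Fin (n G) → ℕ → Set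
WReachSizeAtLeast G r L v k =
  Σ (Fin k → Fin (n G)) λ f → Injective _≡_ _≡_ f × (∀ i → WReach G r L v (f i))

-- wcol_r(G) ≥ k, i.e. min over L of max over v of |WReach_r[G,L,v]| is ≥ k:
-- for every linear order L some vertex v has |WReach_r[G,L,v]| ≥ k.
WcolAtLeast : (G : Graph) → ℕ → ℕ → Set
WcolAtLeast G r k =
  ∀ (L : LinearOrder G) → Σ (Fin (n G)) λ v →
    WReachSizeAtLeast G r (Data.Product.proj₁ L) v k

-- Fix a linear order L. A path whose last vertex is its L-minimum witnesses that this
-- vertex is weakly reachable from the first one; let P_i be the number of such paths with
-- i edges, counted as vertex sequences. By reversal, paths whose minimum is the first
-- vertex are equally many. Prepending to such a path any neighbour of its first vertex
-- other than the second gives again a path (girth), with its minimum at one of the ends.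
-- Hence d P_0 ≤ 2 P_1 and (d-1) P_i ≤ 2 P_(i+1), so P_(t+1) ≥ n d (d-1)^t / 2^(t+1).
-- As two paths with common ends and at most 2g edges in total coincide (girth again),
-- for r ≤ g the paths with 1 to r edges starting at v end at distinct vertices of
-- WReach_r[G,L,v]. Thus ∑_v |WReach_r[v]| ≥ ∑_(i=1..r) P_i ≥ n d ((d-1)^r - 2^r) / ((d-3) 2^r),
-- and some vertex attains the average.

module Submission where

open import Defs hiding (sym)
open import Data.Nat using (ℕ; zero; suc; _+_; _*_; _∸_; _^_; _≤_; z≤n; s≤s)
open import Data.Nat.Properties hiding (_≟_)
open import Data.Fin using (Fin; zero; suc; toℕ; inject₁; inject≤; fromℕ)
open import Data.Fin.Properties using (any?; toℕ<n; toℕ-inject₁; toℕ-fromℕ; toℕ-injective; inject≤-injective)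
  renaming (suc-injective to Fin-suc-injective; _≟_ to _≟ᶠ_)
open import Data.Vec using (Vec; []; _∷_; _∷ʳ_; head; tail; last; reverse; lookup)
open import Data.Vec.Properties using (∷-injective; reverse-∷; reverse-involutive; last-reverse)
open import Data.Product using (Σ; ∃; _×_; _,_; proj₁; proj₂)
open import Data.Sum using (_⊎_; inj₁; inj₂; [_,_]′; map₁)
open import Data.Unit using (⊤; tt)
open import Data.Bool using (T)
open import Data.Bool.Properties using (T?; T-irrelevant)
open import Data.Vec.Relation.Unary.Any using (here; there)
open import Data.Vec.Membership.Propositional.Properties using (∈-lookup)
open import Data.Vec.Relation.Unary.All using (All; []; _∷_; all?)
import Data.Vec.Relation.Unary.All as All
open import Data.Vec.Relation.Unary.Linked using (Linked; []; [-]; _∷_; linked?)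
open import Data.Empty using (⊥; ⊥-elim)
open import Function.Base using (_∘_)
open import Function.Definitions using (Injective)
open import Function.Bundles using (Inverse)
open import Relation.Binary.PropositionalEquality
open import Relation.Nullary using (¬_; Dec; yes; no; ¬?)
open import Relation.Nullary.Decidable using (_×-dec_; _⊎-dec_)
open import Relation.Unary using (Pred; Decidable)
open import Level using (0ℓ)
open import Data.Nat.Tactic.RingSolver using (solve-∀)
open import Algebra.Properties.Semiring.Sum +-*-semiring
  using (sum; sum-cong-≗; sum-init-last; ∑-distrib-+; ∑-comm; *-distribˡ-sum)

𝟙 : ∀ {p} {P : Set p} → Dec P → ℕ
𝟙 (yes _) = 1
𝟙 (no _)  = 0

𝟙-yes : ∀ {p} {P : Set p} (P? : Dec P) → P → 𝟙 P? ≡ 1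
𝟙-yes (yes _) _  = refl
𝟙-yes (no ¬p) p  = ⊥-elim (¬p p)

𝟙≤1 : ∀ {p} {P : Set p} (P? : Dec P) → 𝟙 P? ≤ 1
𝟙≤1 (yes _) = s≤s z≤n
𝟙≤1 (no _)  = z≤n

𝟙-sound : ∀ {p} {P : Set p} (P? : Dec P) → 1 ≤ 𝟙 P? → P
𝟙-sound (yes p) _ = p

𝟙-mono : ∀ {p q} {P : Set p} {Q : Set q} (P? : Dec P) (Q? : Dec Q) → (P → Q) → 𝟙 P? ≤ 𝟙 Q?
𝟙-mono (yes p) Q? f = ≤-reflexive (sym (𝟙-yes Q? (f p)))
𝟙-mono (no _)  Q? f = z≤n

𝟙-⊎ : ∀ {p q r} {P : Set p} {Q : Set q} {R : Set r} (P? : Dec P) (Q? : Dec Q) (R? : Dec R) →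
      (P → Q ⊎ R) → 𝟙 P? ≤ 𝟙 Q? + 𝟙 R?
𝟙-⊎ (no _)  Q? R? cases = z≤n
𝟙-⊎ (yes p) Q? R? cases with cases p
... | inj₁ q = ≤-trans (≤-reflexive (sym (𝟙-yes Q? q))) (m≤m+n _ _)
... | inj₂ r = ≤-trans (≤-reflexive (sym (𝟙-yes R? r))) (m≤n+m _ _)

≤𝟙 : ∀ {p} {P : Set p} (P? : Dec P) {s : ℕ} → s ≤ 1 → (1 ≤ s → P) → s ≤ 𝟙 P?
≤𝟙 (yes _) s≤1 _   = s≤1
≤𝟙 (no ¬p) {zero}  _ _   = z≤n
≤𝟙 (no ¬p) {suc s} _ pos = ⊥-elim (¬p (pos (s≤s z≤n)))

sum-mono : ∀ {m} {f g : Fin m → ℕ} → (∀ a → f a ≤ g a) → sum f ≤ sum g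
sum-mono {zero}  f≤g = z≤n
sum-mono {suc m} f≤g = +-mono-≤ (f≤g zero) (sum-mono (f≤g ∘ suc))

term≤sum : ∀ {m} (f : Fin m → ℕ) a → f a ≤ sum f
term≤sum f zero    = m≤m+n _ _
term≤sum f (suc a) = ≤-trans (term≤sum (f ∘ suc) a) (m≤n+m _ (f zero))

sum-positive : ∀ {m} (f : Fin m → ℕ) → 1 ≤ sum f → ∃ λ a → 1 ≤ f a
sum-positive {suc m} f pos with f zero in f0
... | suc _ = zero , subst (1 ≤_) (sym f0) (s≤s z≤n)
... | zero with sum-positive (f ∘ suc) pos
...   | a , fa>0 = suc a , fa>0

sum-const1 : ∀ m → sum {m} (λ _ → 1) ≡ m
sum-const1 zero    = refl
sum-const1 (suc m) = cong suc (sum-const1 m)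

sum≤1 : ∀ {m} (f : Fin m → ℕ) → (∀ a → f a ≤ 1) → (∀ a b → 1 ≤ f a → 1 ≤ f b → a ≡ b) → sum f ≤ 1
sum≤1 {zero}  f _  _    = z≤n
sum≤1 {suc m} f ≤1 uniq with f zero in f0
... | zero  = sum≤1 (f ∘ suc) (≤1 ∘ suc) (λ a b p q → Fin-suc-injective (uniq (suc a) (suc b) p q))
... | suc x with sum (f ∘ suc) in rest
...   | zero  = subst (λ t → t + 0 ≤ 1) f0 (≤-trans (≤-reflexive (+-identityʳ (f zero))) (≤1 zero))
...   | suc _ with sum-positive (f ∘ suc) (subst (1 ≤_) (sym rest) (s≤s z≤n))
...     | a , fa>0 with uniq zero (suc a) (subst (1 ≤_) (sym f0) (s≤s z≤n)) fa>0
...       | ()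

average : ∀ {m} → 1 ≤ m → (f : Fin m → ℕ) (c : ℕ) → m * c ≤ sum f → ∃ λ a → c ≤ f a
average {suc m} _ = go m
  where
  go : ∀ m (f : Fin (suc m) → ℕ) (c : ℕ) → suc m * c ≤ sum f → ∃ λ a → c ≤ f a
  go zero f c total = zero , subst₂ _≤_ (+-identityʳ c) (+-identityʳ (f zero)) total
  go (suc m) f c total with c ≤? f zero
  ... | yes c≤f0 = zero , c≤f0
  ... | no  c≰f0 with go m (f ∘ suc) c
                        (+-cancelˡ-≤ c _ _ (≤-trans total (+-monoˡ-≤ _ (<⇒≤ (≰⇒> c≰f0)))))
  ...   | a , c≤fa = suc a , c≤fa

count : ∀ {m} {P : Pred (Fin m) 0ℓ} → Decidable P → ℕ
count P? = sum (λ x → 𝟙 (P? x))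

count-point≤1 : ∀ {m} (y : Fin m) → count (_≟ᶠ y) ≤ 1
count-point≤1 y = sum≤1 _ (λ x → 𝟙≤1 (x ≟ᶠ y)) (λ a b p q → trans (𝟙-sound (a ≟ᶠ y) p) (sym (𝟙-sound (b ≟ᶠ y) q)))

count-injection : ∀ {m k} {P : Pred (Fin m) 0ℓ} (P? : Decidable P) (f : Fin k → Fin m) →
                  Injective _≡_ _≡_ f → (∀ j → P (f j)) → k ≤ count P?
count-injection {m} {k} {P} P? f f-inj f∈P = begin
  k                                            ≡⟨ sum-const1 k ⟨
  sum {k} (λ j → 1)                            ≤⟨ sum-mono hit ⟩
  sum (λ j → count (_≟ᶠ f j))                  ≡⟨ ∑-comm (λ j x → 𝟙 (x ≟ᶠ f j)) ⟩
  sum (λ x → sum (λ j → 𝟙 (x ≟ᶠ f j)))         ≤⟨ sum-mono fibre ⟩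
  count P?                                     ∎
  where
  open ≤-Reasoning
  hit : ∀ j → 1 ≤ count (_≟ᶠ f j)
  hit j = ≤-trans (≤-reflexive (sym (𝟙-yes (f j ≟ᶠ f j) refl))) (term≤sum (λ x → 𝟙 (x ≟ᶠ f j)) (f j))
  -- every fibre of f has at most one point, and only points of P have nonempty fibres
  fibre : ∀ x → sum (λ j → 𝟙 (x ≟ᶠ f j)) ≤ 𝟙 (P? x)
  fibre x = ≤𝟙 (P? x)
    (sum≤1 _ (λ j → 𝟙≤1 (x ≟ᶠ f j))
      (λ a b p q → f-inj (trans (sym (𝟙-sound (x ≟ᶠ f a) p)) (𝟙-sound (x ≟ᶠ f b) q))))
    (λ pos → let (j , p) = sum-positive _ pos in subst P (sym (𝟙-sound (x ≟ᶠ f j) p)) (f∈P j))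

enumerate : ∀ {m} {P : Pred (Fin m) 0ℓ} (P? : Decidable P) →
            Σ (Fin (count P?) → Fin m) λ f → Injective _≡_ _≡_ f × (∀ j → P (f j))
enumerate {zero}  P? = (λ ()) , (λ {}) , (λ ())
enumerate {suc m} {P} P? with P? zero | enumerate (P? ∘ suc)
... | yes p0 | f , f-inj , f∈P = g , g-inj , g∈P
  where
  g : Fin (suc (count (P? ∘ suc))) → Fin (suc m)
  g zero    = zero
  g (suc j) = suc (f j)
  g-inj : Injective _≡_ _≡_ g
  g-inj {zero}  {zero}  _  = refl
  g-inj {suc a} {suc b} eq = cong suc (f-inj (Fin-suc-injective eq))
  g∈P : ∀ j → P (g j)
  g∈P zero    = p0
  g∈P (suc j) = f∈P j
... | no _   | f , f-inj , f∈P = suc ∘ f , f-inj ∘ Fin-suc-injective , f∈P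

enumerate≤ : ∀ {m k} {P : Pred (Fin m) 0ℓ} (P? : Decidable P) → k ≤ count P? →
             Σ (Fin k → Fin m) λ f → Injective _≡_ _≡_ f × (∀ j → P (f j))
enumerate≤ P? k≤count with enumerate P?
... | f , f-inj , f∈P =
  (λ j → f (inject≤ j k≤count)) ,
  (λ {a} {b} eq → inject≤-injective k≤count k≤count a b (f-inj eq)) ,
  (λ j → f∈P _)

-- sumRange m P = P 1 + ⋯ + P m.
sumRange : ℕ → (ℕ → ℕ) → ℕ
sumRange m P = sum {m} (λ i → P (suc (toℕ i)))

sumRange-suc : ∀ m P → sumRange (suc m) P ≡ sumRange m P + P (suc m)
sumRange-suc m P = trans (sum-init-last {m} (λ i → P (suc (toℕ i))))
  (cong₂ _+_ (sum-cong-≗ {m} (λ i → cong (P ∘ suc) (toℕ-inject₁ i))) (cong (P ∘ suc) (toℕ-fromℕ m)))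

geometric-growth : ∀ (P : ℕ → ℕ) a c M → a ≤ 2 * P 1 → (∀ j → 2 + j ≤ M → c * P (1 + j) ≤ 2 * P (2 + j)) →
                   ∀ t → 1 + t ≤ M → a * c ^ t ≤ 2 ^ (1 + t) * P (1 + t)
geometric-growth P a c M first later zero _ = begin
  a * 1          ≡⟨ *-identityʳ a ⟩
  a              ≤⟨ first ⟩
  2 * P 1        ≡⟨ cong (_* P 1) (*-identityʳ 2) ⟨
  2 * 1 * P 1    ∎
  where open ≤-Reasoning
geometric-growth P a c M first later (suc t) bound = begin
  a * (c * c ^ t)                 ≡⟨ exchange a c (c ^ t) ⟩
  c * (a * c ^ t)                 ≤⟨ *-monoʳ-≤ c (geometric-growth P a c M first later t (≤-trans (n≤1+n _) bound)) ⟩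
  c * (2 ^ (1 + t) * P (1 + t))   ≡⟨ exchange c (2 ^ (1 + t)) (P (1 + t)) ⟩
  2 ^ (1 + t) * (c * P (1 + t))   ≤⟨ *-monoʳ-≤ (2 ^ (1 + t)) (later t bound) ⟩
  2 ^ (1 + t) * (2 * P (2 + t))   ≡⟨ regroup (2 ^ (1 + t)) (P (2 + t)) ⟩
  2 ^ (2 + t) * P (2 + t)         ∎
  where
  open ≤-Reasoning
  exchange : ∀ x y z → x * (y * z) ≡ y * (x * z)
  exchange = solve-∀
  regroup : ∀ x y → x * (2 * y) ≡ 2 * x * y
  regroup = solve-∀

-- Summing the bounds N (2+e)^t ≤ 2^(t+1) P(t+1) for t < m gives, after multiplying by e,
-- N (2+e)^m ≤ e 2^m ∑_{i=1}^{m} P i + N 2^m  (the geometric series ∑ (2+e)^t 2^(m-1-t)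
-- times e is (2+e)^m - 2^m).
partial-sums : ∀ (P : ℕ → ℕ) N e M → (∀ t → 1 + t ≤ M → N * (2 + e) ^ t ≤ 2 ^ (1 + t) * P (1 + t)) →
               ∀ m → m ≤ M → N * (2 + e) ^ m ≤ e * (2 ^ m * sumRange m P) + N * 2 ^ m
partial-sums P N e M terms zero    _     = m≤n+m (N * 1) (e * 0)
partial-sums P N e M terms (suc m) bound = begin
  N * ((2 + e) * (2 + e) ^ m)                                    ≡⟨ expand N e ((2 + e) ^ m) ⟩
  2 * (N * (2 + e) ^ m) + e * (N * (2 + e) ^ m)                  ≤⟨ +-mono-≤ (*-monoʳ-≤ 2 (partial-sums P N e M terms m (≤-trans (n≤1+n m) bound)))
                                                                              (*-monoʳ-≤ e (terms m bound)) ⟩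
  2 * (e * (2 ^ m * S) + N * 2 ^ m) + e * (2 ^ (1 + m) * P (1 + m)) ≡⟨ collect N e (2 ^ m) S (P (1 + m)) ⟩
  e * (2 ^ (1 + m) * (S + P (1 + m))) + N * 2 ^ (1 + m)           ≡⟨ cong (λ t → e * (2 ^ (1 + m) * t) + N * 2 ^ (1 + m)) (sumRange-suc m P) ⟨
  e * (2 ^ (1 + m) * sumRange (1 + m) P) + N * 2 ^ (1 + m)        ∎
  where
  open ≤-Reasoning
  S : ℕ
  S = sumRange m P
  expand : ∀ N e y → N * ((2 + e) * y) ≡ 2 * (N * y) + e * (N * y)
  expand = solve-∀
  collect : ∀ N e t s p → 2 * (e * (t * s) + N * t) + e * (2 * t * p) ≡ e * (2 * t * (s + p)) + N * (2 * t)
  collect = solve-∀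

least-multiple : ∀ N D b → N ≤ b * D → Σ ℕ λ k → N ≤ k * D × (∀ c → N ≤ c * D → k ≤ c)
least-multiple N D zero    N≤0 = 0 , N≤0 , λ _ _ → z≤n
least-multiple N D (suc b) N≤bD with N ≤? b * D
... | yes N≤b = least-multiple N D b N≤b
... | no  N≰b = suc b , N≤bD , minimal
  where
  minimal : ∀ c → N ≤ c * D → suc b ≤ c
  minimal c N≤c with suc b ≤? c
  ... | yes b<c = b<c
  ... | no  b≮c = ⊥-elim (N≰b (≤-trans N≤c (*-monoˡ-≤ D (≤-pred (≰⇒> b≮c)))))

module _ {N : ℕ} where

  sumSeq : ∀ k → (Vec (Fin N) k → ℕ) → ℕ
  sumSeq zero    f = f []
  sumSeq (suc k) f = sum (λ x → sumSeq k (λ xs → f (x ∷ xs)))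

  sumSeq-cong : ∀ k {f g : Vec (Fin N) k → ℕ} → (∀ xs → f xs ≡ g xs) → sumSeq k f ≡ sumSeq k g
  sumSeq-cong zero    f≗g = f≗g []
  sumSeq-cong (suc k) f≗g = sum-cong-≗ (λ x → sumSeq-cong k (λ xs → f≗g (x ∷ xs)))

  sumSeq-mono : ∀ k {f g : Vec (Fin N) k → ℕ} → (∀ xs → f xs ≤ g xs) → sumSeq k f ≤ sumSeq k g
  sumSeq-mono zero    f≤g = f≤g []
  sumSeq-mono (suc k) f≤g = sum-mono (λ x → sumSeq-mono k (λ xs → f≤g (x ∷ xs)))

  sumSeq-+ : ∀ k (f g : Vec (Fin N) k → ℕ) → sumSeq k (λ xs → f xs + g xs) ≡ sumSeq k f + sumSeq k g
  sumSeq-+ zero    f g = refl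
  sumSeq-+ (suc k) f g = trans (sum-cong-≗ (λ x → sumSeq-+ k (λ xs → f (x ∷ xs)) (λ xs → g (x ∷ xs))))
                               (∑-distrib-+ {N} _ _)

  sumSeq-* : ∀ k c (f : Vec (Fin N) k → ℕ) → sumSeq k (λ xs → c * f xs) ≡ c * sumSeq k f
  sumSeq-* zero    c f = refl
  sumSeq-* (suc k) c f = trans (sum-cong-≗ (λ x → sumSeq-* k c (λ xs → f (x ∷ xs))))
                               (sym (*-distribˡ-sum {N} c _))

  sumSeq-∑ : ∀ k {m} (f : Fin m → Vec (Fin N) k → ℕ) →
             sumSeq k (λ xs → sum (λ a → f a xs)) ≡ sum (λ a → sumSeq k (f a))
  sumSeq-∑ zero    f = refl
  sumSeq-∑ (suc k) f = trans (sum-cong-≗ (λ x → sumSeq-∑ k (λ a xs → f a (x ∷ xs))))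
                             (∑-comm (λ x a → sumSeq k (λ xs → f a (x ∷ xs))))

  sumSeq-positive : ∀ k (f : Vec (Fin N) k → ℕ) → 1 ≤ sumSeq k f → ∃ λ xs → 1 ≤ f xs
  sumSeq-positive zero    f pos = [] , pos
  sumSeq-positive (suc k) f pos with sum-positive _ pos
  ... | x , pos′ with sumSeq-positive k _ pos′
  ...   | xs , fxs>0 = x ∷ xs , fxs>0

  sumSeq≤1 : ∀ k (f : Vec (Fin N) k → ℕ) → (∀ xs → f xs ≤ 1) →
             (∀ xs ys → 1 ≤ f xs → 1 ≤ f ys → xs ≡ ys) → sumSeq k f ≤ 1
  sumSeq≤1 zero    f ≤1 uniq = ≤1 []
  sumSeq≤1 (suc k) f ≤1 uniq =
    sum≤1 _ (λ x → sumSeq≤1 k _ (λ xs → ≤1 (x ∷ xs)) (λ xs ys p q → proj₂ (∷-injective (uniq _ _ p q))))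
      (λ a b p q → let (xs , p′) = sumSeq-positive k _ p
                       (ys , q′) = sumSeq-positive k _ q
                   in proj₁ (∷-injective (uniq _ _ p′ q′)))

  sumSeq-∷ʳ : ∀ k (f : Vec (Fin N) (suc k) → ℕ) → sumSeq (suc k) f ≡ sumSeq k (λ xs → sum (λ x → f (xs ∷ʳ x)))
  sumSeq-∷ʳ zero    f = refl
  sumSeq-∷ʳ (suc k) f = sum-cong-≗ (λ y → sumSeq-∷ʳ k (λ xs → f (y ∷ xs)))

  sumSeq-reverse : ∀ k (f : Vec (Fin N) k → ℕ) → sumSeq k (f ∘ reverse) ≡ sumSeq k f
  sumSeq-reverse zero    f = refl
  sumSeq-reverse (suc k) f = begin
    sumSeq (suc k) (f ∘ reverse)                         ≡⟨ sumSeq-cong (suc k) (λ xs → cong f (reverse-uncons xs)) ⟩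
    sum (λ x → sumSeq k (λ xs → f (reverse xs ∷ʳ x)))   ≡⟨ sumSeq-∑ k (λ x xs → f (reverse xs ∷ʳ x)) ⟨
    sumSeq k (λ xs → sum (λ x → f (reverse xs ∷ʳ x)))   ≡⟨ sumSeq-reverse k (λ ys → sum (λ x → f (ys ∷ʳ x))) ⟩
    sumSeq k (λ ys → sum (λ x → f (ys ∷ʳ x)))           ≡⟨ sumSeq-∷ʳ k f ⟨
    sumSeq (suc k) f                                     ∎
    where
    open ≡-Reasoning
    reverse-uncons : ∀ (xs : Vec (Fin N) (suc k)) → reverse xs ≡ reverse (tail xs) ∷ʳ head xs
    reverse-uncons (x ∷ xs) = reverse-∷ x xs

  anySeq? : ∀ k {P : Pred (Vec (Fin N) k) 0ℓ} → Decidable P → Dec (Σ (Vec (Fin N) k) P)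
  anySeq? zero P? with P? []
  ... | yes p  = yes ([] , p)
  ... | no ¬p  = no λ { ([] , p) → ¬p p }
  anySeq? (suc k) P? with any? (λ x → anySeq? k (λ xs → P? (x ∷ xs)))
  ... | yes (x , xs , p) = yes (x ∷ xs , p)
  ... | no ¬p            = no λ { (x ∷ xs , p) → ¬p (x , xs , p) }

-- Walks and paths in G, represented as vertex sequences; a path with k edges is a
-- sequence of k + 1 distinct vertices, consecutive ones adjacent.

module Walks (G : Graph) where

  Vertex : Set
  Vertex = Fin (n G)

  open import Data.Vec.Membership.DecPropositional (_≟ᶠ_ {n G}) public using (_∈_; _∉_; _∈?_)

  ∑ᵥ : (Vertex → ℕ) → ℕ
  ∑ᵥ = sum {n G}

  E? : ∀ u v → Dec (E G u v)
  E? u v = T? (adj G u v)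

  E-sym : ∀ {u v} → E G u v → E G v u
  E-sym {u} {v} = subst T (Graph.sym G u v)

  E-irrefl : ∀ {u} → ¬ E G u u
  E-irrefl {u} = subst T (Graph.irrefl G u)

  IsWalk : ∀ {k} → Vec Vertex k → Set
  IsWalk = Linked (E G)

  Distinct : ∀ {k} → Vec Vertex k → Set
  Distinct []       = ⊤
  Distinct (x ∷ xs) = x ∉ xs × Distinct xs

  Distinct? : ∀ {k} (xs : Vec Vertex k) → Dec (Distinct xs)
  Distinct? []       = yes tt
  Distinct? (x ∷ xs) = ¬? (x ∈? xs) ×-dec Distinct? xs

  IsPath : ∀ {k} → Vec Vertex k → Set
  IsPath xs = IsWalk xs × Distinct xs

  IsPath? : ∀ {k} (xs : Vec Vertex k) → Dec (IsPath xs)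
  IsPath? xs = linked? E? xs ×-dec Distinct? xs

  ∈-∷ʳ⁻ : ∀ {k z y} (xs : Vec Vertex k) → z ∈ xs ∷ʳ y → z ∈ xs ⊎ z ≡ y
  ∈-∷ʳ⁻ []       (here z≡y) = inj₂ z≡y
  ∈-∷ʳ⁻ (x ∷ xs) (here z≡x) = inj₁ (here z≡x)
  ∈-∷ʳ⁻ (x ∷ xs) (there z∈) = map₁ there (∈-∷ʳ⁻ xs z∈)

  ∈-∷ʳ⁺ˡ : ∀ {k z y} {xs : Vec Vertex k} → z ∈ xs → z ∈ xs ∷ʳ y
  ∈-∷ʳ⁺ˡ (here z≡x) = here z≡x
  ∈-∷ʳ⁺ˡ (there z∈) = there (∈-∷ʳ⁺ˡ z∈)

  ∈-∷ʳ⁺ʳ : ∀ {k y} (xs : Vec Vertex k) → y ∈ xs ∷ʳ y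
  ∈-∷ʳ⁺ʳ []       = here refl
  ∈-∷ʳ⁺ʳ (x ∷ xs) = there (∈-∷ʳ⁺ʳ xs)

  ∈-reverse⁺ : ∀ {k z} {xs : Vec Vertex k} → z ∈ xs → z ∈ reverse xs
  ∈-reverse⁺ {xs = x ∷ xs} (here z≡x) rewrite reverse-∷ x xs | z≡x = ∈-∷ʳ⁺ʳ (reverse xs)
  ∈-reverse⁺ {xs = x ∷ xs} (there z∈) rewrite reverse-∷ x xs = ∈-∷ʳ⁺ˡ (∈-reverse⁺ z∈)

  ∈-reverse⁻ : ∀ {k z} {xs : Vec Vertex k} → z ∈ reverse xs → z ∈ xs
  ∈-reverse⁻ {xs = xs} z∈ = subst (_ ∈_) (reverse-involutive xs) (∈-reverse⁺ z∈)

  last∈ : ∀ {k} (xs : Vec Vertex (suc k)) → last xs ∈ xs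
  last∈ (x ∷ [])     = here refl
  last∈ (x ∷ y ∷ ys) = there (last∈ (y ∷ ys))

  head-reverse : ∀ {k} (xs : Vec Vertex (suc k)) → head (reverse xs) ≡ last xs
  head-reverse xs = trans (sym (last-reverse (reverse xs))) (cong last (reverse-involutive xs))

  IsWalk-∷ʳ : ∀ {k y} {xs : Vec Vertex (suc k)} → IsWalk xs → E G (last xs) y → IsWalk (xs ∷ʳ y)
  IsWalk-∷ʳ [-]                  e = e ∷ [-]
  IsWalk-∷ʳ (_∷_ {xs = _ ∷ _} e w) e′ = e ∷ IsWalk-∷ʳ w e′

  Distinct-∷ʳ : ∀ {k y} {xs : Vec Vertex k} → Distinct xs → y ∉ xs → Distinct (xs ∷ʳ y)
  Distinct-∷ʳ {xs = []}     _          _   = (λ ()) , tt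
  Distinct-∷ʳ {xs = x ∷ xs} (x∉ , dxs) y∉ =
    [ x∉ , (λ x≡y → y∉ (here (sym x≡y))) ]′ ∘ ∈-∷ʳ⁻ xs , Distinct-∷ʳ dxs (y∉ ∘ there)

  IsWalk-reverse : ∀ {k} {xs : Vec Vertex k} → IsWalk xs → IsWalk (reverse xs)
  IsWalk-reverse []  = []
  IsWalk-reverse [-] = [-]
  IsWalk-reverse {xs = x ∷ y ∷ ys} (e ∷ w) rewrite reverse-∷ x (y ∷ ys) =
    IsWalk-∷ʳ (IsWalk-reverse w) (subst (λ z → E G z x) (sym (last-reverse (y ∷ ys))) (E-sym e))

  Distinct-reverse : ∀ {k} {xs : Vec Vertex k} → Distinct xs → Distinct (reverse xs)
  Distinct-reverse {xs = []}     d          = d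
  Distinct-reverse {xs = x ∷ xs} (x∉ , d) rewrite reverse-∷ x xs =
    Distinct-∷ʳ (Distinct-reverse d) (x∉ ∘ ∈-reverse⁻)

  IsPath-reverse : ∀ {k} {xs : Vec Vertex k} → IsPath xs → IsPath (reverse xs)
  IsPath-reverse (w , d) = IsWalk-reverse w , Distinct-reverse d

  lookup-injective : ∀ {k} {xs : Vec Vertex k} → Distinct xs → Injective _≡_ _≡_ (lookup xs)
  lookup-injective {xs = x ∷ xs} d        {zero}  {zero}  _  = refl
  lookup-injective {xs = x ∷ xs} (x∉ , _) {zero}  {suc j} eq = ⊥-elim (x∉ (subst (_∈ xs) (sym eq) (∈-lookup j xs)))
  lookup-injective {xs = x ∷ xs} (x∉ , _) {suc i} {zero}  eq = ⊥-elim (x∉ (subst (_∈ xs) eq (∈-lookup i xs)))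
  lookup-injective {xs = x ∷ xs} (_ , d)  {suc i} {suc j} eq = cong suc (lookup-injective d eq)

  IsWalk-lookup : ∀ {k} {xs : Vec Vertex (suc k)} → IsWalk xs →
                  ∀ (i : Fin k) → E G (lookup xs (inject₁ i)) (lookup xs (suc i))
  IsWalk-lookup {xs = x ∷ y ∷ ys} (e ∷ w) zero    = e
  IsWalk-lookup {xs = x ∷ y ∷ ys} (e ∷ w) (suc i) = IsWalk-lookup w i

  lookup-last : ∀ {k} (xs : Vec Vertex (suc k)) → lookup xs (fromℕ k) ≡ last xs
  lookup-last (x ∷ [])     = refl
  lookup-last (x ∷ y ∷ ys) = lookup-last (y ∷ ys)

  toPath : ∀ {k} (xs : Vec Vertex (suc k)) → IsPath xs → Path G k (head xs) (last xs)
  toPath (x ∷ xs) (w , d) = lookup (x ∷ xs) , lookup-injective d , refl , lookup-last (x ∷ xs) , IsWalk-lookup w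

  All-tabulate : ∀ {k} {P : Vertex → Set} {xs : Vec Vertex k} → (∀ {z} → z ∈ xs → P z) → All P xs
  All-tabulate {xs = []}     _ = []
  All-tabulate {xs = x ∷ xs} f = f (here refl) ∷ All-tabulate (f ∘ there)

  -- Nonempty vertex sequences of any length, so that sequences of different lengths
  -- can be compared.
  Seq : Set
  Seq = Σ ℕ λ k → Vec Vertex (suc k)

  Seq-≡ : ∀ {a} {xs ys : Vec Vertex (suc a)} → _≡_ {A = Seq} (a , xs) (a , ys) → xs ≡ ys
  Seq-≡ refl = refl

  ∷-cong : ∀ {a b x} {xs : Vec Vertex (suc a)} {ys : Vec Vertex (suc b)} →
           _≡_ {A = Seq} (a , xs) (b , ys) → _≡_ {A = Seq} (suc a , x ∷ xs) (suc b , x ∷ ys)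
  ∷-cong refl = refl

  record PathWithin (k : ℕ) (S : Vertex → Set) (a b : Vertex) : Set where
    constructor pathWithin
    field
      {len}    : ℕ
      len≤     : len ≤ k
      vertices : Vec Vertex (suc len)
      starts   : head vertices ≡ a
      ends     : last vertices ≡ b
      isPath   : IsPath vertices
      within   : ∀ {t} → t ∈ vertices → S t

  prefix : ∀ {k z} {ys : Vec Vertex (suc k)} → z ∈ ys → IsPath ys → PathWithin k (_∈ ys) (head ys) z
  prefix {ys = y ∷ ys} (here z≡y) _ =
    pathWithin z≤n (y ∷ []) refl (sym z≡y) ([-] , (λ ()) , tt) λ { (here t≡y) → here t≡y }
  prefix {ys = y ∷ y′ ∷ ys} (there z∈) (e ∷ w , y∉ , d) with prefix z∈ (w , d)
  ... | pathWithin len≤ ws starts ends (w′ , d′) within =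
    pathWithin (s≤s len≤) (y ∷ ws) refl ends (subst (E G y) (sym starts) e ∷ w′ , y∉ ∘ within , d′)
      λ { (here t≡y) → here t≡y ; (there t∈) → there (within t∈) }

  suffix : ∀ {k z} {ys : Vec Vertex (suc k)} → z ∈ ys → IsPath ys → PathWithin k (_∈ ys) z (last ys)
  suffix {ys = y ∷ ys} (here z≡y) p = pathWithin ≤-refl (y ∷ ys) (sym z≡y) refl p (λ t∈ → t∈)
  suffix {ys = y ∷ y′ ∷ ys} (there z∈) (_ ∷ w , _ , d) with suffix z∈ (w , d)
  ... | pathWithin len≤ ws starts ends p within = pathWithin (m≤n⇒m≤1+n len≤) ws starts ends p (there ∘ within)

module ShortPaths (G : Graph) (g : ℕ) (girth : GirthAtLeast (2 * g + 1) G) where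

  open Walks G

  -- A path R with distinct ends and a vertex x outside R adjacent to both ends would
  -- form a cycle of length len R + 2, so there is none of length at most 2g.
  no-short-cycle : ∀ {k x} {R : Vec Vertex (suc k)} → IsPath R → x ∉ R →
                   E G x (head R) → E G (last R) x → head R ≢ last R → 2 + k ≤ 2 * g → ⊥
  no-short-cycle {R = r ∷ []} _ _ _ _ r≢r _ = r≢r refl
  no-short-cycle {suc k} {x} {R = r ∷ r′ ∷ rs} (w , d) x∉R x~r last~x _ short =
    1+n≰n (subst (_≤ 2 * g) (+-comm (2 * g) 1) (≤-trans (girth (3 + k) cycle) short))
    where
    C : Vec Vertex (3 + k)
    C = x ∷ r ∷ r′ ∷ rs
    cycle : Cycle G (3 + k)
    cycle = lookup C , s≤s (s≤s z≤n) , lookup-injective (x∉R , d) , IsWalk-lookup (x~r ∷ w) ,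
            subst (λ z → E G z x) (sym (lookup-last C)) last~x

  join : ∀ {a b v} {P : Vec Vertex (suc a)} {Q : Vec Vertex (suc b)} → IsWalk P → IsPath Q →
         last P ≡ last Q → v ∉ P → v ∉ Q → PathWithin (a + b) (_≢ v) (head P) (head Q)
  join {P = p ∷ []} {Q} _ pQ p≡lastQ v∉P v∉Q =
    pathWithin ≤-refl (reverse Q) (trans (head-reverse Q) (sym p≡lastQ)) (last-reverse Q)
      (IsPath-reverse pQ) (λ t∈ t≡v → v∉Q (subst (_∈ Q) t≡v (∈-reverse⁻ t∈)))
  join {suc a} {b} {v} {P = p ∷ p′ ∷ ps} (e ∷ w) pQ same-end v∉P v∉Q
    with join w pQ same-end (v∉P ∘ there) v∉Q
  ... | R with p ∈? PathWithin.vertices R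
  ...   | no  p∉R = let open PathWithin R in
    pathWithin (s≤s len≤) (p ∷ vertices) refl ends
      (subst (E G p) (sym starts) e ∷ proj₁ isPath , p∉R , proj₂ isPath)
      λ { (here t≡p) t≡v → v∉P (here (trans (sym t≡v) t≡p)) ; (there t∈) → within t∈ }
  ...   | yes p∈R with suffix p∈R (PathWithin.isPath R)
  ...     | pathWithin len≤ vs starts ends isPath within =
    pathWithin (≤-trans len≤ (m≤n⇒m≤1+n (PathWithin.len≤ R))) vs starts (trans ends (PathWithin.ends R))
      isPath (PathWithin.within R ∘ within)

  -- As G has no cycle of length at most 2g, two paths with the same ends and at most 2g
  -- edges in total coincide.
  unique : ∀ {a b} {xs : Vec Vertex (suc a)} {ys : Vec Vertex (suc b)} → IsPath xs → IsPath ys →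
           head xs ≡ head ys → last xs ≡ last ys → a + b ≤ 2 * g → _≡_ {A = Seq} (a , xs) (b , ys)
  unique {xs = x ∷ []} {y ∷ []} _ _ refl _ _ = refl
  unique {xs = x ∷ []} {.x ∷ y′ ∷ ys} _ (_ , x∉ , _) refl x≡last _ =
    ⊥-elim (x∉ (subst (_∈ y′ ∷ ys) (sym x≡last) (last∈ (y′ ∷ ys))))
  unique {xs = x ∷ x′ ∷ xs} {.x ∷ []} (_ , x∉ , _) _ refl last≡x _ =
    ⊥-elim (x∉ (subst (_∈ x′ ∷ xs) last≡x (last∈ (x′ ∷ xs))))
  unique {suc a} {suc b} {x ∷ x′ ∷ xs} {.x ∷ y′ ∷ ys} (e ∷ w , x∉ , d) (e′ ∷ w′ , x∉′ , d′) refl same-end short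
    with x′ ≟ᶠ y′
  ... | yes refl = ∷-cong (unique (w , d) (w′ , d′) refl same-end
                                  (≤-trans (+-monoʳ-≤ a (n≤1+n b)) (≤-trans (n≤1+n _) short)))
  ... | no x′≢y′ with join w (w′ , d′) same-end x∉ x∉′
  ...   | pathWithin len≤ R starts ends pR within =
    ⊥-elim (no-short-cycle pR (λ x∈R → within x∈R refl) (subst (E G x) (sym starts) e)
              (subst (λ z → E G z x) (sym ends) (E-sym e′))
              (λ h≡l → x′≢y′ (trans (sym starts) (trans h≡l ends)))
              (≤-trans (s≤s (s≤s len≤)) (subst (λ t → suc t ≤ 2 * g) (+-suc a b) short)))

  fresh-neighbour : ∀ {j x} {ys : Vec Vertex (2 + j)} → IsPath ys → 2 + j ≤ 2 * g →
                    E G x (head ys) → x ≢ head (tail ys) → x ∉ ys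
  fresh-neighbour {ys = y0 ∷ _} _ _ x~y0 _ (here x≡y0) = E-irrefl (subst (λ z → E G z y0) x≡y0 x~y0)
  fresh-neighbour {ys = _ ∷ _ ∷ _} _ _ _ x≢y1 (there (here x≡y1)) = x≢y1 x≡y1
  fresh-neighbour {ys = y0 ∷ y1 ∷ ys} (e ∷ w , y0∉ , d) short x~y0 x≢y1 (there x∈)
    with prefix x∈ (w , d)
  ... | pathWithin len≤ R starts ends pR within =
    no-short-cycle pR (y0∉ ∘ within) (subst (E G y0) (sym starts) e) (subst (λ z → E G z y0) (sym ends) x~y0)
      (λ h≡l → x≢y1 (trans (sym ends) (trans (sym h≡l) starts))) (≤-trans (s≤s (s≤s len≤)) short)

module MinimumAtEnd (G : Graph) (L : Fin (n G) → ℕ) where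

  open Walks G

  _≼_ : ∀ {k} → Vertex → Vec Vertex k → Set
  m ≼ xs = All (λ y → L m ≤ L y) xs

  _≼?_ : ∀ {k} m (xs : Vec Vertex k) → Dec (m ≼ xs)
  m ≼? xs = all? (λ y → L m ≤? L y) xs

  -- A path whose last vertex is its minimum witnesses weak reachability of its end from its start.
  MinAtEnd : ∀ {k} → Vec Vertex (suc k) → Set
  MinAtEnd xs = IsPath xs × last xs ≼ xs

  MinAtEnd? : ∀ {k} (xs : Vec Vertex (suc k)) → Dec (MinAtEnd xs)
  MinAtEnd? xs = IsPath? xs ×-dec (last xs ≼? xs)

  MinAtStart : ∀ {k} → Vec Vertex (suc k) → Set
  MinAtStart xs = IsPath xs × head xs ≼ xs

  MinAtStart? : ∀ {k} (xs : Vec Vertex (suc k)) → Dec (MinAtStart xs)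
  MinAtStart? xs = IsPath? xs ×-dec (head xs ≼? xs)

  MinAtStart-reverse : ∀ {k} (xs : Vec Vertex (suc k)) → MinAtStart (reverse xs) → MinAtEnd xs
  MinAtStart-reverse xs (p , min) =
    subst IsPath (reverse-involutive xs) (IsPath-reverse p) ,
    All-tabulate (λ z∈ → subst (λ m → L m ≤ L _) (head-reverse xs) (All.lookup min (∈-reverse⁺ z∈)))

  prepend : ∀ {k x} {ys : Vec Vertex (suc k)} → IsPath (x ∷ ys) → MinAtEnd ys →
            MinAtStart (x ∷ ys) ⊎ MinAtEnd (x ∷ ys)
  prepend {x = x} {ys} p (_ , min) with L x ≤? L (last ys)
  ... | yes x≤last = inj₁ (p , ≤-refl ∷ All-tabulate (λ z∈ → ≤-trans x≤last (All.lookup min z∈)))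
  ... | no  x≰last = inj₂ (p , <⇒≤ (≰⇒> x≰last) ∷ min)

  #MinAtEnd : ℕ → ℕ
  #MinAtEnd i = sumSeq (suc i) (𝟙 ∘ MinAtEnd?)

  #MinAtStart : ℕ → ℕ
  #MinAtStart i = sumSeq (suc i) (𝟙 ∘ MinAtStart?)

  #MinAtEnd-0 : #MinAtEnd 0 ≡ n G
  #MinAtEnd-0 = trans (sum-cong-≗ {n G} (λ x → 𝟙-yes (MinAtEnd? (x ∷ [])) (([-] , (λ ()) , tt) , ≤-refl ∷ [])))
                      (sum-const1 (n G))

  -- Reversal maps paths of the second kind to paths of the first kind.
  #MinAtStart≤#MinAtEnd : ∀ i → #MinAtStart i ≤ #MinAtEnd i
  #MinAtStart≤#MinAtEnd i = subst (_≤ #MinAtEnd i) (sumSeq-reverse (suc i) (𝟙 ∘ MinAtStart?))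
    (sumSeq-mono (suc i) (λ xs → 𝟙-mono (MinAtStart? (reverse xs)) (MinAtEnd? xs) (MinAtStart-reverse xs)))

  extensions : ∀ {k} → Vec Vertex (suc k) → ℕ
  extensions ys = ∑ᵥ (λ x → 𝟙 (MinAtStart? (x ∷ ys)) + 𝟙 (MinAtEnd? (x ∷ ys)))

  doubling : ∀ j c → (∀ ys → MinAtEnd ys → c ≤ extensions ys) → c * #MinAtEnd j ≤ 2 * #MinAtEnd (suc j)
  doubling j c enough = begin
    c * #MinAtEnd j                                          ≡⟨ sumSeq-* (suc j) c (𝟙 ∘ MinAtEnd?) ⟨
    sumSeq (suc j) (λ ys → c * 𝟙 (MinAtEnd? ys))             ≤⟨ sumSeq-mono (suc j) extend ⟩
    sumSeq (suc j) extensions                                ≡⟨ sumSeq-∑ (suc j) {n G} (λ x ys → 𝟙 (MinAtStart? (x ∷ ys)) + 𝟙 (MinAtEnd? (x ∷ ys))) ⟩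
    sumSeq (suc (suc j)) (λ xs → 𝟙 (MinAtStart? xs) + 𝟙 (MinAtEnd? xs))  ≡⟨ sumSeq-+ (suc (suc j)) (𝟙 ∘ MinAtStart?) (𝟙 ∘ MinAtEnd?) ⟩
    #MinAtStart (suc j) + #MinAtEnd (suc j)                  ≤⟨ +-monoˡ-≤ _ (#MinAtStart≤#MinAtEnd (suc j)) ⟩
    #MinAtEnd (suc j) + #MinAtEnd (suc j)                    ≡⟨ cong (#MinAtEnd (suc j) +_) (+-identityʳ _) ⟨
    2 * #MinAtEnd (suc j)                                    ∎
    where
    open ≤-Reasoning
    extend : ∀ ys → c * 𝟙 (MinAtEnd? ys) ≤ extensions ys
    extend ys with MinAtEnd? ys
    ... | yes m = subst (_≤ extensions ys) (sym (*-identityʳ c)) (enough ys m)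
    ... | no  _ = subst (_≤ extensions ys) (sym (*-zeroʳ c)) z≤n

module Extensions (G : Graph) (L : Fin (n G) → ℕ) (d : ℕ) (regular : Regular d G)
                  (g : ℕ) (girth : GirthAtLeast (2 * g + 1) G) where

  open Walks G
  open MinimumAtEnd G L
  open ShortPaths G g girth

  neighbours : ∀ h → d ≤ count (λ x → E? x h)
  neighbours h = count-injection (λ x → E? x h) (proj₁ ∘ from) nbr-injective (λ j → E-sym (proj₂ (from j)))
    where
    open Inverse (regular h)
    nbr-injective : Injective _≡_ _≡_ (proj₁ ∘ from)
    nbr-injective {a} {b} eq = begin
      a             ≡⟨ strictlyInverseˡ a ⟨
      to (from a)   ≡⟨ cong to (Σ-≡ (from a) (from b) eq) ⟩
      to (from b)   ≡⟨ strictlyInverseˡ b ⟩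
      b             ∎
      where
      open ≡-Reasoning
      -- adjacency proofs are unique, so a neighbour is determined by its vertex
      Σ-≡ : ∀ (p q : Σ Vertex (E G h)) → proj₁ p ≡ proj₁ q → p ≡ q
      Σ-≡ (u , p) (.u , q) refl = cong (u ,_) (T-irrelevant p q)

  extensions-vertex : ∀ y → d ≤ extensions (y ∷ [])
  extensions-vertex y = ≤-trans (neighbours y) (sum-mono λ x →
    𝟙-⊎ (E? x y) (MinAtStart? (x ∷ y ∷ [])) (MinAtEnd? (x ∷ y ∷ []))
      (λ x~y → prepend (x~y ∷ [-] , (λ { (here x≡y) → E-irrefl (subst (λ z → E G z y) x≡y x~y) }) , (λ ()) , tt)
                       (([-] , (λ ()) , tt) , ≤-refl ∷ [])))

  -- A path with 1 ≤ j + 1 ≤ 2g - 1 edges can be extended by every neighbour of its first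
  -- vertex except the second vertex, so by at least d - 1 of them.
  extensions-path : ∀ {j} (ys : Vec Vertex (2 + j)) → 2 + j ≤ 2 * g → MinAtEnd ys → d ≤ 1 + extensions ys
  extensions-path ys@(y0 ∷ y1 ∷ _) short m@((w , dist) , _) = begin
    d                                                                      ≤⟨ neighbours y0 ⟩
    count (λ x → E? x y0)                                                  ≤⟨ sum-mono extend ⟩
    sum (λ x → 𝟙 (x ≟ᶠ y1) + 𝟙 (either x))                                 ≡⟨ ∑-distrib-+ {n G} _ _ ⟩
    count (_≟ᶠ y1) + sum (λ x → 𝟙 (either x))                              ≤⟨ +-mono-≤ (count-point≤1 y1) (sum-mono split) ⟩
    1 + extensions ys                                                      ∎
    where
    open ≤-Reasoning
    either : ∀ x → Dec (MinAtStart (x ∷ ys) ⊎ MinAtEnd (x ∷ ys))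
    either x = MinAtStart? (x ∷ ys) ⊎-dec MinAtEnd? (x ∷ ys)
    split : ∀ x → 𝟙 (either x) ≤ 𝟙 (MinAtStart? (x ∷ ys)) + 𝟙 (MinAtEnd? (x ∷ ys))
    split x = 𝟙-⊎ (either x) (MinAtStart? (x ∷ ys)) (MinAtEnd? (x ∷ ys)) (λ e → e)
    extend : ∀ x → 𝟙 (E? x y0) ≤ 𝟙 (x ≟ᶠ y1) + 𝟙 (either x)
    extend x = 𝟙-⊎ (E? x y0) (x ≟ᶠ y1) _ cases
      where
      cases : E G x y0 → x ≡ y1 ⊎ (MinAtStart (x ∷ ys) ⊎ MinAtEnd (x ∷ ys))
      cases x~y0 with x ≟ᶠ y1
      ... | yes x≡y1 = inj₁ x≡y1
      ... | no  x≢y1 = inj₂ (prepend (x~y0 ∷ w , fresh-neighbour (w , dist) short x~y0 x≢y1 , dist) m)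

  growth : ∀ t → 1 + t ≤ 2 * g → (d * n G) * (d ∸ 1) ^ t ≤ 2 ^ (1 + t) * #MinAtEnd (1 + t)
  growth = geometric-growth #MinAtEnd (d * n G) (d ∸ 1) (2 * g) first later
    where
    first : d * n G ≤ 2 * #MinAtEnd 1
    first = subst (λ z → d * z ≤ 2 * #MinAtEnd 1) #MinAtEnd-0
              (doubling 0 d (λ { (y ∷ []) _ → extensions-vertex y }))
    later : ∀ j → 2 + j ≤ 2 * g → (d ∸ 1) * #MinAtEnd (1 + j) ≤ 2 * #MinAtEnd (2 + j)
    later j short = doubling (suc j) (d ∸ 1) (λ ys m → m≤n+o⇒m∸n≤o d 1 (extensions-path ys short m))

module WeakReachability (G : Graph) (L : Fin (n G) → ℕ) (g : ℕ) (girth : GirthAtLeast (2 * g + 1) G) where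

  open Walks G
  open MinimumAtEnd G L
  open ShortPaths G g girth

  Witness : ∀ {i} → Vertex → Vertex → Vec Vertex (suc i) → Set
  Witness v u xs = head xs ≡ v × last xs ≡ u × MinAtEnd xs

  Witness? : ∀ {i} v u (xs : Vec Vertex (suc i)) → Dec (Witness v u xs)
  Witness? v u xs = (head xs ≟ᶠ v) ×-dec (last xs ≟ᶠ u) ×-dec MinAtEnd? xs

  #Witness : ℕ → Vertex → Vertex → ℕ
  #Witness i v u = sumSeq (suc i) (𝟙 ∘ Witness? v u)

  #MinAtEnd≤ : ∀ i → #MinAtEnd i ≤ ∑ᵥ (λ v → ∑ᵥ (λ u → #Witness i v u))
  #MinAtEnd≤ i = begin
    #MinAtEnd i                                                        ≤⟨ sumSeq-mono (suc i) by-ends ⟩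
    sumSeq (suc i) (λ xs → ∑ᵥ (λ v → ∑ᵥ (λ u → 𝟙 (Witness? v u xs)))) ≡⟨ sumSeq-∑ (suc i) {n G} (λ v xs → ∑ᵥ (λ u → 𝟙 (Witness? v u xs))) ⟩
    ∑ᵥ (λ v → sumSeq (suc i) (λ xs → ∑ᵥ (λ u → 𝟙 (Witness? v u xs)))) ≡⟨ sum-cong-≗ {n G} (λ v → sumSeq-∑ (suc i) {n G} (λ u xs → 𝟙 (Witness? v u xs))) ⟩
    ∑ᵥ (λ v → ∑ᵥ (λ u → #Witness i v u))                             ∎
    where
    open ≤-Reasoning
    by-ends : ∀ xs → 𝟙 (MinAtEnd? xs) ≤ ∑ᵥ (λ v → ∑ᵥ (λ u → 𝟙 (Witness? v u xs)))
    by-ends xs = begin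
      𝟙 (MinAtEnd? xs)                                    ≤⟨ 𝟙-mono (MinAtEnd? xs) (Witness? (head xs) (last xs) xs) (λ m → refl , refl , m) ⟩
      𝟙 (Witness? (head xs) (last xs) xs)                 ≤⟨ term≤sum (λ u → 𝟙 (Witness? (head xs) u xs)) (last xs) ⟩
      ∑ᵥ (λ u → 𝟙 (Witness? (head xs) u xs))             ≤⟨ term≤sum (λ v → ∑ᵥ (λ u → 𝟙 (Witness? v u xs))) (head xs) ⟩
      ∑ᵥ (λ v → ∑ᵥ (λ u → 𝟙 (Witness? v u xs)))         ∎

  Reaches : ℕ → Vertex → Vertex → Set
  Reaches r v u = Σ (Fin r) λ i → Σ (Vec Vertex (2 + toℕ i)) (Witness v u)

  Reaches? : ∀ r v u → Dec (Reaches r v u)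
  Reaches? r v u = any? (λ i → anySeq? (2 + toℕ i) (Witness? v u))

  Reaches⇒WReach : ∀ {r v u} → Reaches r v u → WReach G r L v u
  Reaches⇒WReach {r} (i , xs@(_ ∷ _) , refl , refl , p , min) =
    suc (toℕ i) , toℕ<n i , toPath xs p , λ j → All.lookup min (∈-lookup j xs)

  -- For r ≤ g, by uniqueness of short paths, u is the end of at most one path from v
  -- with at most r edges ending at its minimum.
  witnesses≤reaches : ∀ {r} → r ≤ g → ∀ v u → sumRange r (λ i → #Witness i v u) ≤ 𝟙 (Reaches? r v u)
  witnesses≤reaches {r} r≤g v u = ≤𝟙 (Reaches? r v u) (sum≤1 (λ i → #Witness (suc (toℕ i)) v u) one-length same-length) reaches
    where
    short : ∀ (i j : Fin r) → suc (toℕ i) + suc (toℕ j) ≤ 2 * g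
    short i j = ≤-trans (+-mono-≤ (≤-trans (toℕ<n i) r≤g) (≤-trans (toℕ<n j) r≤g))
                        (≤-reflexive (cong (g +_) (sym (+-identityʳ g))))
    unique-witness : ∀ i j {xs ys} → Witness v u xs → Witness v u ys → _≡_ {A = Seq} (suc (toℕ i) , xs) (suc (toℕ j) , ys)
    unique-witness i j (h , l , p , _) (h′ , l′ , p′ , _) = unique p p′ (trans h (sym h′)) (trans l (sym l′)) (short i j)
    witness : ∀ i → 1 ≤ #Witness (suc (toℕ i)) v u → Σ (Vec Vertex (2 + toℕ i)) (Witness v u)
    witness i pos = let (xs , q) = sumSeq-positive (2 + toℕ i) (𝟙 ∘ Witness? v u) pos in xs , 𝟙-sound (Witness? v u xs) q
    one-length : ∀ i → #Witness (suc (toℕ i)) v u ≤ 1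
    one-length i = sumSeq≤1 (2 + toℕ i) (𝟙 ∘ Witness? v u) (λ xs → 𝟙≤1 (Witness? v u xs))
      (λ xs ys p q → Seq-≡ (unique-witness i i (𝟙-sound (Witness? v u xs) p) (𝟙-sound (Witness? v u ys) q)))
    same-length : ∀ i j → 1 ≤ #Witness (suc (toℕ i)) v u → 1 ≤ #Witness (suc (toℕ j)) v u → i ≡ j
    same-length i j p q = toℕ-injective (suc-injective (cong proj₁
      (unique-witness i j (proj₂ (witness i p)) (proj₂ (witness j q)))))
    reaches : 1 ≤ sumRange r (λ i → #Witness i v u) → Reaches r v u
    reaches pos = let (i , q) = sum-positive _ pos in i , witness i q

  #MinAtEnd≤reach : ∀ {r} → r ≤ g → sumRange r #MinAtEnd ≤ ∑ᵥ (λ v → count (Reaches? r v))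
  #MinAtEnd≤reach {r} r≤g = begin
    sumRange r #MinAtEnd                                            ≤⟨ sum-mono {r} (λ i → #MinAtEnd≤ (suc (toℕ i))) ⟩
    sum {r} (λ i → ∑ᵥ (λ v → ∑ᵥ (λ u → #Witness (suc (toℕ i)) v u))) ≡⟨ ∑-comm {r} {n G} (λ i v → ∑ᵥ (λ u → #Witness (suc (toℕ i)) v u)) ⟩
    ∑ᵥ (λ v → sum {r} (λ i → ∑ᵥ (λ u → #Witness (suc (toℕ i)) v u))) ≡⟨ sum-cong-≗ {n G} (λ v → ∑-comm {r} {n G} (λ i u → #Witness (suc (toℕ i)) v u)) ⟩
    ∑ᵥ (λ v → ∑ᵥ (λ u → sumRange r (λ i → #Witness i v u)))       ≤⟨ sum-mono (λ v → sum-mono (witnesses≤reaches r≤g v)) ⟩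
    ∑ᵥ (λ v → count (Reaches? r v))                                ∎
    where open ≤-Reasoning

  WReach-size : ∀ {r v k} → k ≤ count (Reaches? r v) → WReachSizeAtLeast G r L v k
  WReach-size {r} {v} k≤ with enumerate≤ (Reaches? r v) k≤
  ... | f , f-inj , reached = f , f-inj , Reaches⇒WReach ∘ reached

module DoubleCounting (G : Graph) (L : Fin (n G) → ℕ) (e : ℕ) (regular : Regular (3 + e) G)
                      (g : ℕ) (girth : GirthAtLeast (2 * g + 1) G) where

  open Walks G
  open MinimumAtEnd G L
  open Extensions G L (3 + e) regular g girth
  open WeakReachability G L g girth

  reach-total : ∀ r → r ≤ g →
                n G * ((3 + e) * ((2 + e) ^ r ∸ 2 ^ r)) ≤ ∑ᵥ (λ v → count (Reaches? r v) * (e * 2 ^ r))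
  reach-total r r≤g = begin
    n G * (d * ((2 + e) ^ r ∸ 2 ^ r))              ≡⟨ distribute (n G) d ((2 + e) ^ r) (2 ^ r) ⟩
    d * n G * (2 + e) ^ r ∸ d * n G * 2 ^ r        ≤⟨ m≤n+o⇒m∸n≤o _ _ (subst (d * n G * (2 + e) ^ r ≤_) (+-comm _ (d * n G * 2 ^ r)) summed) ⟩
    e * (2 ^ r * sumRange r #MinAtEnd)             ≤⟨ *-monoʳ-≤ e (*-monoʳ-≤ (2 ^ r) (#MinAtEnd≤reach r≤g)) ⟩
    e * (2 ^ r * ∑ᵥ c)                             ≡⟨ cong (e *_) (*-distribˡ-sum {n G} (2 ^ r) c) ⟩
    e * ∑ᵥ (λ v → 2 ^ r * c v)                     ≡⟨ *-distribˡ-sum {n G} e _ ⟩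
    ∑ᵥ (λ v → e * (2 ^ r * c v))                   ≡⟨ sum-cong-≗ {n G} (λ v → rotate e (2 ^ r) (c v)) ⟩
    ∑ᵥ (λ v → c v * (e * 2 ^ r))                   ∎
    where
    open ≤-Reasoning
    d : ℕ
    d = 3 + e
    c : Vertex → ℕ
    c v = count (Reaches? r v)
    summed : d * n G * (2 + e) ^ r ≤ e * (2 ^ r * sumRange r #MinAtEnd) + d * n G * 2 ^ r
    summed = partial-sums #MinAtEnd (d * n G) e (2 * g) growth r (≤-trans r≤g (m≤m+n g _))
    distribute : ∀ a b x y → a * (b * (x ∸ y)) ≡ b * a * x ∸ b * a * y
    distribute a b x y = begin-equality
      a * (b * (x ∸ y))     ≡⟨ *-assoc a b (x ∸ y) ⟨
      a * b * (x ∸ y)       ≡⟨ *-distribˡ-∸ (a * b) x y ⟩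
      a * b * x ∸ a * b * y ≡⟨ cong (λ t → t * x ∸ t * y) (*-comm a b) ⟩
      b * a * x ∸ b * a * y ∎
    rotate : ∀ x y z → x * (y * z) ≡ z * (x * y)
    rotate = solve-∀

-- wcol_r(G) ≥ d/(d-3) (((d-1)/2)^r - 1), i.e. wcol_r(G) ≥ k for the least k with
-- d((d-1)^r - 2^r) ≤ k (d-3) 2^r.
theorem5 : (d g : ℕ) → 4 ≤ d → 1 ≤ g → (G : Graph) → 1 ≤ n G
    → Regular d G → GirthAtLeast (2 * g + 1) G
    → (r : ℕ) → 1 ≤ r → r ≤ g
    → Σ ℕ λ k → (d * ((d ∸ 1) ^ r ∸ 2 ^ r) ≤ k * ((d ∸ 3) * 2 ^ r)) × WcolAtLeast G r k
theorem5 (suc (suc (suc e@(suc e′)))) g (s≤s (s≤s (s≤s (s≤s _)))) _ G n≥1 regular girth r _ r≤g =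
  k , N≤kD , wcol
  where
  N D : ℕ
  N = (3 + e) * ((2 + e) ^ r ∸ 2 ^ r)
  D = e * 2 ^ r
  N≤ND : N ≤ N * D
  N≤ND = subst (_≤ N * D) (*-identityʳ N) (*-monoʳ-≤ N (*-mono-≤ (s≤s (z≤n {e′})) (m^n>0 2 r)))
  -- k is the least number with N ≤ k D; it does not depend on the order
  least : Σ ℕ λ k → N ≤ k * D × (∀ c → N ≤ c * D → k ≤ c)
  least = least-multiple N D N N≤ND
  k : ℕ
  k = proj₁ least
  N≤kD : N ≤ k * D
  N≤kD = proj₁ (proj₂ least)
  wcol : WcolAtLeast G r k
  wcol (L , _) = v , WReach-size (proj₂ (proj₂ least) _ N≤cD)
    where
    open WeakReachability G L g girth
    open DoubleCounting G L e regular g girth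
    average-vertex : ∃ λ v → N ≤ count (Reaches? r v) * D
    average-vertex = average n≥1 (λ v → count (Reaches? r v) * D) N (reach-total r r≤g)
    v : Fin (n G)
    v = proj₁ average-vertex
    N≤cD : N ≤ count (Reaches? r v) * D
    N≤cD = proj₂ average-vertex
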